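{- Let $G$ be an $\mathrm{AND}_\ell$-gadget ($\ell\ge1$) with in-terminals $B$ and out-terminals $a_0,a_1$, and let $\pi$ be a stable partition of $V(G)$ such that $B$ is $\pi$-closed and $\pi[B]$ is a partition of $B$ into binary blocks. If $\pi$ does not distinguish $a_0$ from $a_1$, then at least one in-terminal pair is not distinguished by $\pi$.
   Context: Gadgets: $\mathrm{AND}_1$ has vertices $a_0,a_1,b_0,b_1$ and edges $a_0b_0,a_1b_1$. $\mathrm{AND}_2$ has vertices $a_0,a_1,b_0,\ldots,b_3,c_0,\ldots,c_3$ and edges $a_0c_0,a_0c_1,a_1c_2,a_1c_3,b_0c_0,b_0c_2,b_1c_1,b_1c_3,b_2c_1,b_2c_2,b_3c_0,b_3c_3$. For $\ell\ge3$, $\mathrm{AND}_\ell$ is obtained from a copy $G^*$ of $\mathrm{AND}_2$ and two copies $G',G''$ of $\mathrm{AND}_{\ell-1}$ by adding edges joining the out-terminals $a_0,a_1$ of $G'$ to the in-terminals $b_0,b_1$ of $G^*$, and the out-terminals $a_0,a_1$ of $G''$ to $b_2,b_3$ of $G^*$, respectively; its out-terminals are those of $G^*$ and its in-terminal sequence is that of $G'$ followed by that of $G''$. The in-terminals are $B=\{b_0,\ldots,b_{2^\ell-1}\}$; binary blocks of $B$ are the sets $\{b_i: q2^{\ell-j}\le i\le(q+1)2^{\ell-j}-1\}$ ($0\le j\le\ell$, $0\le q<2^j$); in-terminal pairs are $\{b_{2p},b_{2p+1}\}$. $\pi$ is stable if for all $u,v$ in a common cell and every cell $R$, $|N(u)\cap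 R|=|N(v)\cap R|$. $B$ is $\pi$-closed if it is a union of cells of $\pi$; $\pi[B]$ is the induced partition on $B$. $\pi$ distinguishes $x$ from $y$ (or a pair $\{x,y\}$) if $x,y$ lie in different cells. -}

module Defs where

open import Data.Nat using (ℕ; zero; suc; _+_; _*_; _∸_; _^_; _≤_; _<_; _≟_)
open import Data.Nat.Properties using (+-identityʳ)
open import Data.Fin using (Fin; toℕ; splitAt; cast) renaming (zero to fz; suc to fs)
open import Data.Bool using (Bool; true; false; _∧_; _∨_)
open import Data.Maybe using (Maybe; just; nothing)
open import Data.List using (List; []; _∷_; _++_; map; length; filterᵇ)
open import Data.Sum using (_⊎_; inj₁; inj₂)
open import Data.Product using (Σ; _×_; _,_; ∃; ∃-syntax)
open import Relation.Nullary using (does)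
open import Relation.Binary.PropositionalEquality using (_≡_)
open import Function using (_∘_; _⇔_)

data V1 : Set where
  a0 a1 b0 b1 : V1

data V2 : Set where
  a0 a1 b0 b1 b2 b3 c0 c1 c2 c3 : V2

-- Vtx k = vertex set of AND_(k+1)  (so ℓ = suc k ≥ 1).
-- For ℓ ≥ 3: inj₁ = G* (copy of AND_2), inj₂ ∘ inj₁ = G', inj₂ ∘ inj₂ = G''.
Vtx : ℕ → Set
Vtx zero = V1
Vtx (suc zero) = V2
Vtx (suc (suc k)) = V2 ⊎ (Vtx (suc k) ⊎ Vtx (suc k))

-- Listing of all vertices (each exactly once).
allV : ∀ k → List (Vtx k)
allV zero = a0 ∷ a1 ∷ b0 ∷ b1 ∷ []
allV (suc zero) = a0 ∷ a1 ∷ b0 ∷ b1 ∷ b2 ∷ b3 ∷ c0 ∷ c1 ∷ c2 ∷ c3 ∷ []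
allV (suc (suc k)) =
  map inj₁ (allV (suc zero)) ++
  (map (inj₂ ∘ inj₁) (allV (suc k)) ++ map (inj₂ ∘ inj₂) (allV (suc k)))

outT : ∀ k → Fin 2 → Vtx k
outT zero fz = a0
outT zero (fs _) = a1
outT (suc zero) fz = a0
outT (suc zero) (fs _) = a1
outT (suc (suc k)) fz = inj₁ a0
outT (suc (suc k)) (fs _) = inj₁ a1

outIx : ∀ k → Vtx k → Maybe (Fin 2)
outIx zero a0 = just fz
outIx zero a1 = just (fs fz)
outIx zero _ = nothing
outIx (suc zero) a0 = just fz
outIx (suc zero) a1 = just (fs fz)
outIx (suc zero) _ = nothing
outIx (suc (suc k)) (inj₁ x) = outIx (suc zero) x
outIx (suc (suc k)) (inj₂ _) = nothing

inT : ∀ k → Fin (2 ^ suc k) → Vtx k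
inT zero fz = b0
inT zero (fs _) = b1
inT (suc zero) fz = b0
inT (suc zero) (fs fz) = b1
inT (suc zero) (fs (fs fz)) = b2
inT (suc zero) (fs (fs (fs _))) = b3
inT (suc (suc k)) i = glue (2 ^ suc (suc k)) (inT (suc k)) (splitAt (2 ^ suc (suc k)) i)
  where
  glue : ∀ {A : Set} m → (Fin m → A) → Fin m ⊎ Fin (m + 0) → V2 ⊎ (A ⊎ A)
  glue m f (inj₁ j) = inj₂ (inj₁ (f j))
  glue m f (inj₂ j) = inj₂ (inj₂ (f (cast (+-identityʳ m) j)))

-- Directed edge lists (adjacency is the symmetric closure below).
e1 : V1 → V1 → Bool
e1 a0 b0 = true
e1 a1 b1 = true
e1 _ _ = false

e2 : V2 → V2 → Bool
e2 a0 c0 = true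
e2 a0 c1 = true
e2 a1 c2 = true
e2 a1 c3 = true
e2 b0 c0 = true
e2 b0 c2 = true
e2 b1 c1 = true
e2 b1 c3 = true
e2 b2 c1 = true
e2 b2 c2 = true
e2 b3 c0 = true
e2 b3 c3 = true
e2 _ _ = false

-- out-terminal a_0 / a_1 of G' joined to b_0 / b_1 of G*
linkL : Maybe (Fin 2) → V2 → Bool
linkL (just fz) b0 = true
linkL (just (fs _)) b1 = true
linkL _ _ = false

-- out-terminal a_0 / a_1 of G'' joined to b_2 / b_3 of G*
linkR : Maybe (Fin 2) → V2 → Bool
linkR (just fz) b2 = true
linkR (just (fs _)) b3 = true
linkR _ _ = false

E : ∀ k → Vtx k → Vtx k → Bool
E zero x y = e1 x y
E (suc zero) x y = e2 x y
E (suc (suc k)) (inj₁ x) (inj₁ y) = e2 x y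
E (suc (suc k)) (inj₂ (inj₁ x)) (inj₂ (inj₁ y)) = E (suc k) x y
E (suc (suc k)) (inj₂ (inj₂ x)) (inj₂ (inj₂ y)) = E (suc k) x y
E (suc (suc k)) (inj₂ (inj₁ x)) (inj₁ y) = linkL (outIx (suc k) x) y
E (suc (suc k)) (inj₂ (inj₂ x)) (inj₁ y) = linkR (outIx (suc k) x) y
E (suc (suc k)) _ _ = false

adj : ∀ k → Vtx k → Vtx k → Bool
adj k x y = E k x y ∨ E k y x

-- A partition π of V(G) is given by a colouring col : V → ℕ; cells = nonempty fibres.
-- |N(u) ∩ R| where R is the cell of colour r:
degIn : ∀ k → (Vtx k → ℕ) → Vtx k → ℕ → ℕ
degIn k col u r = length (filterᵇ (λ w → adj k u w ∧ does (col w ≟ r)) (allV k))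

Stable : ∀ k → (Vtx k → ℕ) → Set
Stable k col = ∀ u v → col u ≡ col v → ∀ r → degIn k col u r ≡ degIn k col v r

BClosed : ∀ k → (Vtx k → ℕ) → Set
BClosed k col = ∀ i v → col (inT k i) ≡ col v → ∃[ i' ] inT k i' ≡ v

InBlock : ℕ → ℕ → ℕ → ℕ → Set
InBlock ℓ j q i = (q * 2 ^ (ℓ ∸ j) ≤ i) × (i < suc q * 2 ^ (ℓ ∸ j))

BinaryBlocks : ∀ k → (Vtx k → ℕ) → Set
BinaryBlocks k col = ∀ i → Σ ℕ λ j → Σ ℕ λ q → (j ≤ suc k) × (q < 2 ^ j) ×
  (∀ i' → (col (inT k i') ≡ col (inT k i)) ⇔ InBlock (suc k) j q (toℕ i'))

SomePairUndistinguished : ∀ k → (Vtx k → ℕ) → Set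
SomePairUndistinguished k col = Σ ℕ λ p → Σ (Fin (2 ^ suc k)) λ i → Σ (Fin (2 ^ suc k)) λ i' →
  (toℕ i ≡ 2 * p) × (toℕ i' ≡ suc (2 * p)) × (col (inT k i) ≡ col (inT k i'))

module Submission where

-- Either two distinct in-terminals share a cell of π, or π is
-- discrete on B.  In the first case that cell is a binary block with at
-- least two elements, so it contains an in-terminal pair {b_2p, b_2p+1},
-- which π does not distinguish.  In the second case a stable partition that
-- is discrete on the π-closed set B is discrete on the whole gadget, so it
-- distinguishes a_0 from a_1, contrary to the hypothesis.
--
-- The propagation of discreteness works for any graph with a *layering*:
-- a depth function, zero exactly on B, changing by at most one along an
-- edge, such that every vertex of positive depth has two children one level
-- lower which determine it among the vertices of its depth.  For a stable
-- colouring depth is a colour invariant, and by induction on depth two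
-- vertices of one colour coincide.

open import Defs
open import Data.Nat using (ℕ; zero; suc; _+_; _*_; _∸_; _^_; _≤_; _<_; z≤n; s≤s; s≤s⁻¹; _≤?_)
import Data.Nat as ℕ
open import Data.Nat.Properties hiding (_≟_)
open import Data.Fin using (Fin; zero; suc; toℕ; fromℕ<; splitAt; cast; _↑ˡ_; _↑ʳ_; #_)
import Data.Fin.Properties as Fin
open import Data.Bool using (Bool; T; _∧_)
open import Data.Bool.Properties using (T-∧)
open import Data.Maybe using (Maybe; just; nothing)
import Data.Maybe.Properties as Maybe
open import Data.List using (List; _∷_; length; filterᵇ; tabulate; map)
open import Data.List.Membership.Propositional using (_∈_)
open import Data.List.Membership.Propositional.Properties using (∈-map⁺; ∈-++⁺ˡ; ∈-++⁺ʳ; ∈-filter⁺; ∈-filter⁻; ∈-tabulate⁺)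
open import Data.List.Relation.Unary.Any using (here)
open import Data.Vec using (_∷_; []; lookup)
open import Data.Sum using (_⊎_; inj₁; inj₂)
open import Data.Product using (Σ; _×_; _,_; proj₁; proj₂; ∃-syntax)
open import Data.Empty using (⊥-elim)
open import Relation.Nullary using (Dec; yes; no; does; ¬?)
open import Relation.Nullary.Decidable using (map′; _×-dec_; _→-dec_; T?; from-yes; decidable-stable)
open import Relation.Binary using (DecidableEquality)
open import Relation.Binary.PropositionalEquality using (_≡_; _≢_; refl; sym; trans; cong; subst)
open import Function using (_∘_; _⇔_; Equivalence)

open Equivalence using (to; from)

-- (1) Finite verification.

-- Universal statements with
-- decidable instances over such a type are decidable, so facts about the
-- finite base gadgets can be checked by evaluation (with from-yes).
record Enumeration (V : Set) (n : ℕ) : Set where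
  field
    element : Fin n → V
    index : V → Fin n
    element-index : ∀ x → element (index x) ≡ x

  every? : {P : V → Set} → (∀ x → Dec (P x)) → Dec (∀ x → P x)
  every? {P} P? = map′ (λ all x → subst P (element-index x) (all (index x)))
                       (λ all i → all (element i))
                       (Fin.all? (λ i → P? (element i)))

  infix 4 _≟_
  _≟_ : DecidableEquality V
  x ≟ y = map′ index-injective (cong index) (index x Fin.≟ index y)
    where
    index-injective : index x ≡ index y → x ≡ y
    index-injective e = trans (sym (element-index x)) (trans (cong element e) (element-index y))

  ∈-elements : ∀ x → x ∈ tabulate element
  ∈-elements x = subst (_∈ tabulate element) (element-index x) (∈-tabulate⁺ (index x))

-- (2) Stable colourings of layered graphs.

degree : {V : Set} → List V → (V → V → Bool) → (V → ℕ) → V → ℕ → ℕ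
degree vertices adj col u r = length (filterᵇ (λ w → adj u w ∧ does (col w ℕ.≟ r)) vertices)

IsStable : {V : Set} → List V → (V → V → Bool) → (V → ℕ) → Set
IsStable vertices adj col = ∀ u v → col u ≡ col v → ∀ r → degree vertices adj col u r ≡ degree vertices adj col v r

IsClosed : {V I : Set} → (I → V) → (V → ℕ) → Set
IsClosed inT col = ∀ i v → col (inT i) ≡ col v → ∃[ i' ] inT i' ≡ v

Below : {V : Set} → (V → V → Bool) → (V → ℕ) → V → V → Set
Below adj depth u w = T (adj u w) × suc (depth w) ≡ depth u

record Layering {V I : Set} (adj : V → V → Bool) (inT : I → V) : Set where
  field
    depth : V → ℕ
    depth-step : ∀ u w → T (adj u w) → depth u ≤ suc (depth w)
    depth-inT : ∀ i → depth (inT i) ≡ 0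
    ground : ∀ x → depth x ≡ 0 → ∃[ i ] inT i ≡ x
    child₁ child₂ : V → V
    children-below : ∀ u → 0 < depth u → Below adj depth u (child₁ u) × Below adj depth u (child₂ u)
    determined : ∀ u v → 0 < depth u → T (adj v (child₁ u)) → T (adj v (child₂ u)) → depth v ≡ depth u → v ≡ u

inhabited-by-length : ∀ {A : Set} {x : A} {xs ys : List A} → length xs ≡ length ys → x ∈ xs → ∃[ y ] y ∈ ys
inhabited-by-length {xs = _ ∷ _} {ys = y ∷ _} _ _ = y , here refl

module Refinement {V I : Set} (vertices : List V) (complete : ∀ x → x ∈ vertices)
  {adj : V → V → Bool} {inT : I → V} (L : Layering adj inT)
  (col : V → ℕ) (stable : IsStable vertices adj col) (closed : IsClosed inT col) where
  open Layering L

  neighbour-transfer : ∀ {u v w} → col u ≡ col v → T (adj u w) → ∃[ w' ] T (adj v w') × col w' ≡ col w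
  neighbour-transfer {u} {v} {w} same uw = w' , proj₁ found , ≡ᵇ⇒≡ (col w') (col w) (proj₂ found)
    where
    inCellOfW : V → V → Bool
    inCellOfW x y = adj x y ∧ does (col y ℕ.≟ col w)
    w∈ : w ∈ filterᵇ (inCellOfW u) vertices
    w∈ = ∈-filter⁺ (T? ∘ inCellOfW u) (complete w) (from T-∧ (uw , ≡⇒≡ᵇ (col w) (col w) refl))
    -- v has as many neighbours in the cell of w as u, hence at least one
    witness : ∃[ w' ] w' ∈ filterᵇ (inCellOfW v) vertices
    witness = inhabited-by-length (stable u v same (col w)) w∈
    w' : V
    w' = proj₁ witness
    found : T (adj v w') × T (col w' ℕ.≡ᵇ col w)
    found = to T-∧ (proj₂ (∈-filter⁻ (T? ∘ inCellOfW v) {xs = vertices} (proj₂ witness)))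

  -- Depth zero is a union of cells, since B is.
  zero-cell : ∀ {u v} → depth u ≡ 0 → col u ≡ col v → depth v ≡ 0
  zero-cell {u} du same with ground u du
  ... | i , refl with closed i _ same
  ... | i' , refl = depth-inT i'

  -- A vertex coloured like u has at most u's depth: follow a child of u.
  depth-bound : ∀ d u v → depth u ≡ d → col u ≡ col v → depth v ≤ d
  depth-bound zero u v du same = ≤-reflexive (zero-cell du same)
  depth-bound (suc d) u v du same with children-below u (subst (0 <_) (sym du) (s≤s z≤n))
  ... | (uc , dc) , _ with neighbour-transfer same uc
  ... | w' , vw' , same' =
    ≤-trans (depth-step v w' vw') (s≤s (depth-bound d (child₁ u) w' (suc-injective (trans dc du)) (sym same')))

  depth-invariant : ∀ {u v} → col u ≡ col v → depth u ≡ depth v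
  depth-invariant {u} {v} same = ≤-antisym (depth-bound _ v u refl (sym same)) (depth-bound _ u v refl same)

  module _ (discrete-on-B : ∀ i i' → col (inT i) ≡ col (inT i') → i ≡ i') where

    -- Discreteness spreads upwards: a vertex is determined by its children,
    -- which are discrete by induction.
    discrete-at : ∀ d u v → depth u ≡ d → col u ≡ col v → u ≡ v
    discrete-at zero u v du same with ground u du
    ... | i , refl with closed i v same
    ... | i' , refl = cong inT (discrete-on-B i i' same)
    discrete-at (suc d) u v du same =
      sym (determined u v pos (adjacent (proj₁ children)) (adjacent (proj₂ children)) (sym (depth-invariant same)))
      where
      pos : 0 < depth u
      pos = subst (0 <_) (sym du) (s≤s z≤n)
      children = children-below u pos
      adjacent : ∀ {c} → Below adj depth u c → T (adj v c)
      adjacent {c} (uc , dc) with neighbour-transfer same uc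
      ... | w' , vw' , same' = subst (T ∘ adj v) (discrete-at d w' c (trans (depth-invariant same') (suc-injective (trans dc du))) same') vw'

    discrete : ∀ u v → col u ≡ col v → u ≡ v
    discrete u v = discrete-at _ u v refl

-- (3) Binary blocks.

-- x lies in the q-th block of size 2^t; InBlock ℓ j q x is Block (ℓ ∸ j) q x.
Block : ℕ → ℕ → ℕ → Set
Block t q x = q * 2 ^ t ≤ x × x < suc q * 2 ^ t

block-singleton : ∀ {q x} → Block 0 q x → x ≡ q
block-singleton {q} {x} (lower , upper) =
  ≤-antisym (s≤s⁻¹ (subst (x <_) (*-identityʳ (suc q)) upper)) (subst (_≤ x) (*-identityʳ q) lower)

double-start : ∀ s q → 2 * (q * 2 ^ s) ≡ q * 2 ^ suc s
double-start s q = trans (sym (*-assoc 2 q (2 ^ s))) (trans (cong (_* 2 ^ s) (*-comm 2 q)) (*-assoc q 2 (2 ^ s)))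

block-pair : ∀ s q → Block (suc s) q (2 * (q * 2 ^ s)) × Block (suc s) q (suc (2 * (q * 2 ^ s)))
block-pair s q rewrite double-start s q = (≤-refl , m<n+m n (m^n>0 2 (suc s))) , (n≤1+n n , +-monoˡ-≤ n two≤size)
  where
  n = q * 2 ^ suc s
  two≤size : 2 ≤ 2 ^ suc s
  two≤size = *-monoʳ-≤ 2 (m^n>0 2 s)

block-within : ∀ {ℓ j q} → j ≤ ℓ → q < 2 ^ j → suc q * 2 ^ (ℓ ∸ j) ≤ 2 ^ ℓ
block-within {ℓ} {j} j≤ℓ q< =
  ≤-trans (*-monoˡ-≤ (2 ^ (ℓ ∸ j)) q<)
          (≤-reflexive (trans (sym (^-distribˡ-+-* 2 j (ℓ ∸ j))) (cong (2 ^_) (m+[n∸m]≡n j≤ℓ))))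

cell-pair : ∀ {N} (c : Fin N → ℕ) (i i' : Fin N) t q → suc q * 2 ^ t ≤ N
  → (∀ x → (c x ≡ c i) ⇔ Block t q (toℕ x)) → i ≢ i' → c i ≡ c i'
  → Σ ℕ λ p → Σ (Fin N) λ x → Σ (Fin N) λ x' → (toℕ x ≡ 2 * p) × (toℕ x' ≡ suc (2 * p)) × (c x ≡ c x')
cell-pair c i i' zero q _ cell i≢i' same =
  ⊥-elim (i≢i' (Fin.toℕ-injective (trans (block-singleton {q} (to (cell i) refl)) (sym (block-singleton {q} (to (cell i') (sym same)))))))
cell-pair {N} c i i' (suc s) q within cell _ _ =
  p , x , x' , Fin.toℕ-fromℕ< x<N , Fin.toℕ-fromℕ< x'<N , trans (member x even) (sym (member x' odd))
  where
  p = q * 2 ^ s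
  x'<N : suc (2 * p) < N
  x'<N = <-≤-trans (proj₂ (proj₂ (block-pair s q))) within
  x<N : 2 * p < N
  x<N = <-trans (n<1+n (2 * p)) x'<N
  x x' : Fin N
  x = fromℕ< x<N
  x' = fromℕ< x'<N
  even : Block (suc s) q (toℕ x)
  even = subst (Block (suc s) q) (sym (Fin.toℕ-fromℕ< x<N)) (proj₁ (block-pair s q))
  odd : Block (suc s) q (toℕ x')
  odd = subst (Block (suc s) q) (sym (Fin.toℕ-fromℕ< x'<N)) (proj₂ (block-pair s q))
  member : ∀ y → Block (suc s) q (toℕ y) → c y ≡ c i
  member y = from (cell y)

collision-or-injective : ∀ {n} (c : Fin n → ℕ)
  → (∃[ i ] ∃[ i' ] i ≢ i' × c i ≡ c i') ⊎ (∀ i i' → c i ≡ c i' → i ≡ i')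
collision-or-injective c with Fin.any? (λ i → Fin.any? (λ i' → ¬? (i Fin.≟ i') ×-dec (c i ℕ.≟ c i')))
... | yes collision = inj₁ collision
... | no none = inj₂ λ i i' same → decidable-stable (i Fin.≟ i') (λ i≢i' → none (i , i' , i≢i' , same))

-- (4) The layering of the AND-gadgets.

-- The vertex types of AND_1 and AND_2 are enumerated in the order of allV.
enumeration₁ : Enumeration V1 4
enumeration₁ = record { element = lookup (a0 ∷ a1 ∷ b0 ∷ b1 ∷ []) ; index = index ; element-index = element-index }
  where
  index : V1 → Fin 4
  index a0 = # 0
  index a1 = # 1
  index b0 = # 2
  index b1 = # 3
  element-index : ∀ x → lookup (a0 ∷ a1 ∷ b0 ∷ b1 ∷ []) (index x) ≡ x
  element-index a0 = refl
  element-index a1 = refl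
  element-index b0 = refl
  element-index b1 = refl

enumeration₂ : Enumeration V2 10
enumeration₂ = record { element = lookup vertices ; index = index ; element-index = element-index }
  where
  vertices = a0 ∷ a1 ∷ b0 ∷ b1 ∷ b2 ∷ b3 ∷ c0 ∷ c1 ∷ c2 ∷ c3 ∷ []
  index : V2 → Fin 10
  index a0 = # 0
  index a1 = # 1
  index b0 = # 2
  index b1 = # 3
  index b2 = # 4
  index b3 = # 5
  index c0 = # 6
  index c1 = # 7
  index c2 = # 8
  index c3 = # 9
  element-index : ∀ x → lookup vertices (index x) ≡ x
  element-index a0 = refl
  element-index a1 = refl
  element-index b0 = refl
  element-index b1 = refl
  element-index b2 = refl
  element-index b3 = refl
  element-index c0 = refl
  element-index c1 = refl
  element-index c2 = refl
  element-index c3 = refl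

allV-complete : ∀ k x → x ∈ allV k
allV-complete zero = Enumeration.∈-elements enumeration₁
allV-complete (suc zero) = Enumeration.∈-elements enumeration₂
allV-complete (suc (suc k)) (inj₁ x) = ∈-++⁺ˡ (∈-map⁺ inj₁ (allV-complete 1 x))
allV-complete (suc (suc k)) (inj₂ (inj₁ y)) =
  ∈-++⁺ʳ (map inj₁ (allV 1)) (∈-++⁺ˡ (∈-map⁺ (inj₂ ∘ inj₁) (allV-complete (suc k) y)))
allV-complete (suc (suc k)) (inj₂ (inj₂ y)) =
  ∈-++⁺ʳ (map inj₁ (allV 1)) (∈-++⁺ʳ (map (inj₂ ∘ inj₁) (allV (suc k))) (∈-map⁺ (inj₂ ∘ inj₂) (allV-complete (suc k) y)))

-- Depth of the out-terminals of AND_(k+1).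
top : ℕ → ℕ
top zero = 1
top (suc zero) = 2
top (suc (suc k)) = 3 + top (suc k)

-- In AND_1 the out-terminals lie above the in-terminals; in AND_2 the
-- c-layer lies between them; in AND_ℓ, ℓ ≥ 3, the copy G* of AND_2 lies
-- above both sub-gadgets, its in-terminals just above their out-terminals.
depth : ∀ k → Vtx k → ℕ
depth zero a0 = 1
depth zero a1 = 1
depth zero b0 = 0
depth zero b1 = 0
depth (suc zero) a0 = 2
depth (suc zero) a1 = 2
depth (suc zero) b0 = 0
depth (suc zero) b1 = 0
depth (suc zero) b2 = 0
depth (suc zero) b3 = 0
depth (suc zero) c0 = 1
depth (suc zero) c1 = 1
depth (suc zero) c2 = 1
depth (suc zero) c3 = 1
depth (suc (suc k)) (inj₁ x) = depth 1 x + suc (top (suc k))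
depth (suc (suc k)) (inj₂ (inj₁ y)) = depth (suc k) y
depth (suc (suc k)) (inj₂ (inj₂ y)) = depth (suc k) y

-- The in-terminals b0, ..., b3 of G* have as children the out-terminal of
-- a sub-gadget linked to them; the other vertices of G* keep their children
-- in AND_2.
star-child : ∀ k → (V2 → V2) → V2 → Vtx (suc (suc k))
star-child k f b0 = inj₂ (inj₁ (outT (suc k) zero))
star-child k f b1 = inj₂ (inj₁ (outT (suc k) (suc zero)))
star-child k f b2 = inj₂ (inj₂ (outT (suc k) zero))
star-child k f b3 = inj₂ (inj₂ (outT (suc k) (suc zero)))
star-child k f x = inj₁ (f x)

-- The two children of the vertices of AND_2 in the layer below.
left₂ right₂ : V2 → V2
left₂ a0 = c0
left₂ a1 = c2
left₂ c0 = b0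
left₂ c1 = b1
left₂ c2 = b0
left₂ c3 = b1
left₂ x = x
right₂ a0 = c1
right₂ a1 = c3
right₂ c0 = b3
right₂ c1 = b2
right₂ c2 = b2
right₂ c3 = b3
right₂ x = x

child₁ child₂ : ∀ k → Vtx k → Vtx k
child₁ zero a0 = b0
child₁ zero a1 = b1
child₁ zero x = x
child₁ (suc zero) = left₂
child₁ (suc (suc k)) (inj₁ x) = star-child k left₂ x
child₁ (suc (suc k)) (inj₂ (inj₁ y)) = inj₂ (inj₁ (child₁ (suc k) y))
child₁ (suc (suc k)) (inj₂ (inj₂ y)) = inj₂ (inj₂ (child₁ (suc k) y))
child₂ zero = child₁ zero
child₂ (suc zero) = right₂
child₂ (suc (suc k)) (inj₁ x) = star-child k right₂ x
child₂ (suc (suc k)) (inj₂ (inj₁ y)) = inj₂ (inj₁ (child₂ (suc k) y))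
child₂ (suc (suc k)) (inj₂ (inj₂ y)) = inj₂ (inj₂ (child₂ (suc k) y))

BelowIn : ∀ k → Vtx k → Vtx k → Set
BelowIn k = Below (adj k) (depth k)

module BaseChecks {k n : ℕ} (E : Enumeration (Vtx k) n) where
  open Enumeration E

  step? : Dec (∀ u w → T (adj k u w) → depth k u ≤ suc (depth k w))
  step? = every? λ u → every? λ w → T? (adj k u w) →-dec depth k u ≤? suc (depth k w)

  inT-depth? : Dec (∀ i → depth k (inT k i) ≡ 0)
  inT-depth? = Fin.all? λ i → depth k (inT k i) ℕ.≟ 0

  ground? : Dec (∀ x → depth k x ≡ 0 → ∃[ i ] inT k i ≡ x)
  ground? = every? λ x → (depth k x ℕ.≟ 0) →-dec Fin.any? (λ i → inT k i ≟ x)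

  below? : ∀ u w → Dec (BelowIn k u w)
  below? u w = T? (adj k u w) ×-dec (suc (depth k w) ℕ.≟ depth k u)

  children-below? : Dec (∀ u → 0 < depth k u → BelowIn k u (child₁ k u) × BelowIn k u (child₂ k u))
  children-below? = every? λ u → (0 ℕ.<? depth k u) →-dec (below? u (child₁ k u) ×-dec below? u (child₂ k u))

  determined? : Dec (∀ u v → 0 < depth k u → T (adj k v (child₁ k u)) → T (adj k v (child₂ k u)) → depth k v ≡ depth k u → v ≡ u)
  determined? = every? λ u → every? λ v → (0 ℕ.<? depth k u) →-dec T? (adj k v (child₁ k u)) →-dec
    T? (adj k v (child₂ k u)) →-dec (depth k v ℕ.≟ depth k u) →-dec v ≟ u

  depth≤top? : Dec (∀ x → depth k x ≤ top k)
  depth≤top? = every? λ x → depth k x ≤? top k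

  out-top? : Dec (∀ x i → outIx k x ≡ just i → depth k x ≡ top k)
  out-top? = every? λ x → Fin.all? λ i → Maybe.≡-dec Fin._≟_ (outIx k x) (just i) →-dec (depth k x ℕ.≟ top k)

module Checks₁ = BaseChecks enumeration₁
module Checks₂ = BaseChecks enumeration₂

LinksOut : (Maybe (Fin 2) → V2 → Bool) → Set
LinksOut link = ∀ m y → T (link m y) → ∃[ i ] m ≡ just i × depth 1 y ≡ 0

LinksUniquely : (Maybe (Fin 2) → V2 → Bool) → Set
LinksUniquely link = ∀ i y p → T (link (just i) p) → T (link (just i) y) → y ≡ p

module LinkChecks (link : Maybe (Fin 2) → V2 → Bool) where
  open Enumeration enumeration₂

  links-in? : Dec (∀ i y → T (link (just i) y) → depth 1 y ≡ 0)
  links-in? = Fin.all? λ i → every? λ y → T? (link (just i) y) →-dec (depth 1 y ℕ.≟ 0)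

  links-uniquely? : Dec (LinksUniquely link)
  links-uniquely? = Fin.all? λ i → every? λ y → every? λ p → T? (link (just i) p) →-dec T? (link (just i) y) →-dec y ≟ p

linkL-out : LinksOut linkL
linkL-out nothing y ()
linkL-out (just i) y h = i , refl , from-yes (LinkChecks.links-in? linkL) i y h

linkR-out : LinksOut linkR
linkR-out nothing y ()
linkR-out (just i) y h = i , refl , from-yes (LinkChecks.links-in? linkR) i y h

linkL-uniquely : LinksUniquely linkL
linkL-uniquely = from-yes (LinkChecks.links-uniquely? linkL)

linkR-uniquely : LinksUniquely linkR
linkR-uniquely = from-yes (LinkChecks.links-uniquely? linkR)

inT-cases : ∀ k i → (∃[ j ] inT (suc (suc k)) i ≡ inj₂ (inj₁ (inT (suc k) j)))
                  ⊎ (∃[ j ] inT (suc (suc k)) i ≡ inj₂ (inj₂ (inT (suc k) j)))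
inT-cases k i with splitAt (2 ^ suc (suc k)) i
... | inj₁ j = inj₁ (j , refl)
... | inj₂ j = inj₂ (_ , refl)

inT-left : ∀ k j → inT (suc (suc k)) (j ↑ˡ (2 ^ suc (suc k) + 0)) ≡ inj₂ (inj₁ (inT (suc k) j))
inT-left k j rewrite Fin.splitAt-↑ˡ (2 ^ suc (suc k)) j (2 ^ suc (suc k) + 0) = refl

inT-right : ∀ k j → inT (suc (suc k)) (2 ^ suc (suc k) ↑ʳ cast (sym (+-identityʳ _)) j) ≡ inj₂ (inj₂ (inT (suc k) j))
inT-right k j rewrite Fin.splitAt-↑ʳ (2 ^ suc (suc k)) (2 ^ suc (suc k) + 0) (cast (sym (+-identityʳ _)) j)
                    | Fin.cast-involutive (+-identityʳ (2 ^ suc (suc k))) (sym (+-identityʳ _)) j = refl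

depth≤top : ∀ k x → depth k x ≤ top k
depth≤top zero = from-yes Checks₁.depth≤top?
depth≤top (suc zero) = from-yes Checks₂.depth≤top?
depth≤top (suc (suc k)) (inj₁ x) = +-monoˡ-≤ (suc (top (suc k))) (depth≤top 1 x)
depth≤top (suc (suc k)) (inj₂ (inj₁ y)) = ≤-trans (depth≤top (suc k) y) (m≤n+m _ 3)
depth≤top (suc (suc k)) (inj₂ (inj₂ y)) = ≤-trans (depth≤top (suc k) y) (m≤n+m _ 3)

out-top : ∀ k x i → outIx k x ≡ just i → depth k x ≡ top k
out-top zero = from-yes Checks₁.out-top?
out-top (suc zero) = from-yes Checks₂.out-top?
out-top (suc (suc k)) (inj₁ x) i e = cong (_+ suc (top (suc k))) (out-top 1 x i e)

outIx-outT : ∀ k i → outIx k (outT k i) ≡ just i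
outIx-outT zero zero = refl
outIx-outT zero (suc zero) = refl
outIx-outT (suc zero) zero = refl
outIx-outT (suc zero) (suc zero) = refl
outIx-outT (suc (suc k)) zero = refl
outIx-outT (suc (suc k)) (suc zero) = refl

outT-top : ∀ k i → depth k (outT k i) ≡ top k
outT-top k i = out-top k (outT k i) i (outIx-outT k i)

sub<star : ∀ k x y → depth (suc k) y < depth 1 x + suc (top (suc k))
sub<star k x y = ≤-trans (s≤s (depth≤top (suc k) y)) (m≤n+m (suc (top (suc k))) (depth 1 x))

sub-inT-depth : ∀ k → (∀ j → depth (suc k) (inT (suc k) j) ≡ 0) → ∀ i → depth (suc (suc k)) (inT (suc (suc k)) i) ≡ 0
sub-inT-depth k sub i with inT-cases k i
... | inj₁ (j , e) = subst (λ x → depth (suc (suc k)) x ≡ 0) (sym e) (sub j)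
... | inj₂ (j , e) = subst (λ x → depth (suc (suc k)) x ≡ 0) (sym e) (sub j)

depth-inT : ∀ k i → depth k (inT k i) ≡ 0
depth-inT zero = from-yes Checks₁.inT-depth?
depth-inT (suc zero) = from-yes Checks₂.inT-depth?
depth-inT (suc (suc k)) = sub-inT-depth k (depth-inT (suc k))

ground : ∀ k x → depth k x ≡ 0 → ∃[ i ] inT k i ≡ x
ground zero = from-yes Checks₁.ground?
ground (suc zero) = from-yes Checks₂.ground?
ground (suc (suc k)) (inj₁ x) e = ⊥-elim (m+1+n≢0 (depth 1 x) e)
ground (suc (suc k)) (inj₂ (inj₁ y)) e with ground (suc k) y e
... | j , refl = _ , inT-left k j
ground (suc (suc k)) (inj₂ (inj₂ y)) e with ground (suc k) y e
... | j , refl = _ , inT-right k j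

port-step : ∀ k x y → ∃[ i ] outIx (suc k) x ≡ just i × depth 1 y ≡ 0
  → depth 1 y + suc (top (suc k)) ≤ suc (depth (suc k) x)
port-step k x y (i , e , y-in) rewrite y-in | out-top (suc k) x i e = ≤-refl

-- Along an edge the depth drops by at most one: inside G* and the
-- sub-gadgets as in the smaller gadgets, across a link as in port-step.
depth-step : ∀ k u w → T (adj k u w) → depth k u ≤ suc (depth k w)
depth-step zero = from-yes Checks₁.step?
depth-step (suc zero) = from-yes Checks₂.step?
depth-step (suc (suc k)) (inj₁ x) (inj₁ y) h = +-monoˡ-≤ (suc (top (suc k))) (depth-step 1 x y h)
depth-step (suc (suc k)) (inj₂ (inj₁ x)) (inj₂ (inj₁ y)) h = depth-step (suc k) x y h
depth-step (suc (suc k)) (inj₂ (inj₂ x)) (inj₂ (inj₂ y)) h = depth-step (suc k) x y h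
depth-step (suc (suc k)) (inj₁ y) (inj₂ (inj₁ x)) h = port-step k x y (linkL-out _ y h)
depth-step (suc (suc k)) (inj₁ y) (inj₂ (inj₂ x)) h = port-step k x y (linkR-out _ y h)
depth-step (suc (suc k)) (inj₂ (inj₁ x)) (inj₁ y) _ = ≤-trans (<⇒≤ (sub<star k y x)) (n≤1+n _)
depth-step (suc (suc k)) (inj₂ (inj₂ x)) (inj₁ y) _ = ≤-trans (<⇒≤ (sub<star k y x)) (n≤1+n _)
depth-step (suc (suc k)) (inj₂ (inj₁ x)) (inj₂ (inj₂ y)) ()
depth-step (suc (suc k)) (inj₂ (inj₂ x)) (inj₂ (inj₁ y)) ()

port-below : ∀ k (link : Maybe (Fin 2) → V2 → Bool) i {p} → T (link (just i) p)
  → T (link (outIx (suc k) (outT (suc k) i)) p) × suc (depth (suc k) (outT (suc k) i)) ≡ suc (top (suc k))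
port-below k link i {p} h = subst (λ m → T (link m p)) (sym (outIx-outT (suc k) i)) h , cong ℕ.suc (outT-top (suc k) i)

star-below : ∀ k x → 0 < depth 1 x
  → BelowIn (suc (suc k)) (inj₁ x) (inj₁ (left₂ x)) × BelowIn (suc (suc k)) (inj₁ x) (inj₁ (right₂ x))
star-below k x pos with from-yes Checks₂.children-below? x pos
... | (a₁ , d₁) , (a₂ , d₂) = (a₁ , cong (_+ suc (top (suc k))) d₁) , (a₂ , cong (_+ suc (top (suc k))) d₂)

children-below : ∀ k u → 0 < depth k u → BelowIn k u (child₁ k u) × BelowIn k u (child₂ k u)
children-below zero = from-yes Checks₁.children-below?
children-below (suc zero) = from-yes Checks₂.children-below?
children-below (suc (suc k)) (inj₁ b0) _ = let c = port-below k linkL zero _ in c , c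
children-below (suc (suc k)) (inj₁ b1) _ = let c = port-below k linkL (suc zero) _ in c , c
children-below (suc (suc k)) (inj₁ b2) _ = let c = port-below k linkR zero _ in c , c
children-below (suc (suc k)) (inj₁ b3) _ = let c = port-below k linkR (suc zero) _ in c , c
children-below (suc (suc k)) (inj₁ a0) _ = star-below k a0 (s≤s z≤n)
children-below (suc (suc k)) (inj₁ a1) _ = star-below k a1 (s≤s z≤n)
children-below (suc (suc k)) (inj₁ c0) _ = star-below k c0 (s≤s z≤n)
children-below (suc (suc k)) (inj₁ c1) _ = star-below k c1 (s≤s z≤n)
children-below (suc (suc k)) (inj₁ c2) _ = star-below k c2 (s≤s z≤n)
children-below (suc (suc k)) (inj₁ c3) _ = star-below k c3 (s≤s z≤n)
children-below (suc (suc k)) (inj₂ (inj₁ y)) pos = children-below (suc k) y pos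
children-below (suc (suc k)) (inj₂ (inj₂ y)) pos = children-below (suc k) y pos

port-determined : ∀ k (link : Maybe (Fin 2) → V2 → Bool) i {p} y → LinksUniquely link
  → T (link (just i) p) → T (link (outIx (suc k) (outT (suc k) i)) y) → inj₁ y ≡ inj₁ {B = Vtx (suc k) ⊎ Vtx (suc k)} p
port-determined k link i y unique hp hy = cong inj₁ (unique i y _ hp (subst (λ m → T (link m y)) (outIx-outT (suc k) i) hy))

star-determined : ∀ k x y → 0 < depth 1 x → T (adj 1 y (left₂ x)) → T (adj 1 y (right₂ x))
  → depth 1 y + suc (top (suc k)) ≡ depth 1 x + suc (top (suc k)) → inj₁ y ≡ inj₁ {B = Vtx (suc k) ⊎ Vtx (suc k)} x
star-determined k x y pos h₁ h₂ e = cong inj₁ (from-yes Checks₂.determined? x y pos h₁ h₂ (+-cancelʳ-≡ _ _ _ e))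

-- A vertex of positive depth is the only vertex of its depth adjacent to
-- both its children.  Across G* and the sub-gadgets this fails by depth.
determined : ∀ k u v → 0 < depth k u → T (adj k v (child₁ k u)) → T (adj k v (child₂ k u)) → depth k v ≡ depth k u → v ≡ u
determined zero = from-yes Checks₁.determined?
determined (suc zero) = from-yes Checks₂.determined?
determined (suc (suc k)) (inj₁ x) (inj₂ (inj₁ y)) _ _ _ e = ⊥-elim (<⇒≢ (sub<star k x y) e)
determined (suc (suc k)) (inj₁ x) (inj₂ (inj₂ y)) _ _ _ e = ⊥-elim (<⇒≢ (sub<star k x y) e)
determined (suc (suc k)) (inj₂ (inj₁ x)) (inj₁ y) _ _ _ e = ⊥-elim (<⇒≢ (sub<star k y x) (sym e))
determined (suc (suc k)) (inj₂ (inj₂ x)) (inj₁ y) _ _ _ e = ⊥-elim (<⇒≢ (sub<star k y x) (sym e))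
determined (suc (suc k)) (inj₂ (inj₁ x)) (inj₂ (inj₁ y)) pos h₁ h₂ e = cong (inj₂ ∘ inj₁) (determined (suc k) x y pos h₁ h₂ e)
determined (suc (suc k)) (inj₂ (inj₂ x)) (inj₂ (inj₂ y)) pos h₁ h₂ e = cong (inj₂ ∘ inj₂) (determined (suc k) x y pos h₁ h₂ e)
determined (suc (suc k)) (inj₂ (inj₁ x)) (inj₂ (inj₂ y)) _ () _ _
determined (suc (suc k)) (inj₂ (inj₂ x)) (inj₂ (inj₁ y)) _ () _ _
determined (suc (suc k)) (inj₁ b0) (inj₁ y) _ h _ _ = port-determined k linkL zero y linkL-uniquely _ h
determined (suc (suc k)) (inj₁ b1) (inj₁ y) _ h _ _ = port-determined k linkL (suc zero) y linkL-uniquely _ h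
determined (suc (suc k)) (inj₁ b2) (inj₁ y) _ h _ _ = port-determined k linkR zero y linkR-uniquely _ h
determined (suc (suc k)) (inj₁ b3) (inj₁ y) _ h _ _ = port-determined k linkR (suc zero) y linkR-uniquely _ h
determined (suc (suc k)) (inj₁ a0) (inj₁ y) _ = star-determined k a0 y (s≤s z≤n)
determined (suc (suc k)) (inj₁ a1) (inj₁ y) _ = star-determined k a1 y (s≤s z≤n)
determined (suc (suc k)) (inj₁ c0) (inj₁ y) _ = star-determined k c0 y (s≤s z≤n)
determined (suc (suc k)) (inj₁ c1) (inj₁ y) _ = star-determined k c1 y (s≤s z≤n)
determined (suc (suc k)) (inj₁ c2) (inj₁ y) _ = star-determined k c2 y (s≤s z≤n)
determined (suc (suc k)) (inj₁ c3) (inj₁ y) _ = star-determined k c3 y (s≤s z≤n)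

layering : ∀ k → Layering (adj k) (inT k)
layering k = record
  { depth = depth k
  ; depth-step = depth-step k
  ; depth-inT = depth-inT k
  ; ground = ground k
  ; child₁ = child₁ k
  ; child₂ = child₂ k
  ; children-below = children-below k
  ; determined = determined k
  }

outT-distinct : ∀ k → outT k zero ≢ outT k (suc zero)
outT-distinct zero ()
outT-distinct (suc zero) ()
outT-distinct (suc (suc k)) ()

collision-pair : ∀ k col → BinaryBlocks k col → ∀ i i' → i ≢ i' → col (inT k i) ≡ col (inT k i')
  → SomePairUndistinguished k col
collision-pair k col blocks i i' i≢i' same with blocks i
... | j , q , j≤ℓ , q< , cell = cell-pair (col ∘ inT k) i i' (suc k ∸ j) q (block-within j≤ℓ q<) cell i≢i' same

corollary1 : (k : ℕ) (col : Vtx k → ℕ) → Stable k col → BClosed k col → BinaryBlocks k col → col (outT k zero) ≡ col (outT k (suc zero)) → SomePairUndistinguished k col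
corollary1 k col stable closed blocks same-out with collision-or-injective (col ∘ inT k)
... | inj₁ (i , i' , i≢i' , same) = collision-pair k col blocks i i' i≢i' same
... | inj₂ discrete-on-B = ⊥-elim (outT-distinct k (discrete discrete-on-B _ _ same-out))
  where open Refinement (allV k) (allV-complete k) (layering k) col stable closed
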